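{- For all integers $n\geq 4$ and $k\geq 1$ with $(n,k)\neq(4,1)$, $R(kP_n,J_4)=kn+1$.
   Context: All graphs are finite and simple. For graphs $G$ and $H$, the Ramsey number $R(G,H)$ is the least natural number $N$ such that for every graph $F$ on $N$ vertices, either $F$ contains $G$ as a subgraph or the complement $\overline{F}$ contains $H$ as a subgraph. $P_n$ denotes the path on $n$ vertices, and $kP_n$ denotes the disjoint union of $k$ copies of $P_n$. For $m\geq 2$, the Jahangir graph $J_{2m}$ is the graph consisting of a cycle $C_{2m}$ together with one additional vertex adjacent to $m$ alternate vertices of $C_{2m}$; in particular $J_4$ is a $4$-cycle plus a vertex adjacent to two opposite vertices of it (i.e. $J_4\cong K_{2,3}$). -}

module Defs where

open import Data.Nat using (ℕ; zero; suc; _<_; _+_; _*_; _≡ᵇ_)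
open import Data.Empty using (⊥-elim)
open import Data.Bool using (Bool; true; false; _∧_; _∨_; not; if_then_else_)
open import Data.Bool.Properties using (∨-comm; ∧-comm)
open import Data.Fin using (Fin; toℕ; zero; suc)
open import Data.Fin.Properties using (_≟_)
open import Data.Product using (_×_; _,_; Σ; ∃; Σ-syntax)
open import Data.Sum using (_⊎_)
open import Relation.Nullary using (¬_; yes; no; does)
open import Relation.Nullary.Decidable using (⌊_⌋)
open import Relation.Binary.PropositionalEquality using (_≡_; refl; sym; cong)
open import Function.Definitions using (Injective)

record SimpleGraph (V : Set) : Set where
  field
    adj    : V → V → Bool
    adj-sym : ∀ u v → adj u v ≡ adj v u
    irrefl : ∀ v → adj v v ≡ false
open SimpleGraph public

complement : ∀ {N} → SimpleGraph (Fin N) → SimpleGraph (Fin N)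
complement {N} F = record { adj = a ; adj-sym = s ; irrefl = ir }
  where
  a : Fin N → Fin N → Bool
  a u v = not ⌊ u ≟ v ⌋ ∧ not (adj F u v)
  s : ∀ u v → a u v ≡ a v u
  s u v with u ≟ v | v ≟ u
  ... | yes _ | yes _ = refl
  ... | yes p | no ¬q = ⊥-elim (¬q (sym p))
  ... | no ¬p | yes q = ⊥-elim (¬p (sym q))
  ... | no _  | no _  = cong not (SimpleGraph.adj-sym F u v)
  ir : ∀ v → a v v ≡ false
  ir v with v ≟ v
  ... | yes _ = refl
  ... | no ¬p = ⊥-elim (¬p refl)

_⊆_ : ∀ {V W : Set} → SimpleGraph V → SimpleGraph W → Set
_⊆_ {V} {W} H G =
  Σ[ f ∈ (V → W) ] (Injective _≡_ _≡_ f ×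
    (∀ u v → adj H u v ≡ true → adj G (f u) (f v) ≡ true))

Arrows : ∀ {V W : Set} → ℕ → SimpleGraph V → SimpleGraph W → Set
Arrows N G H = (F : SimpleGraph (Fin N)) → (G ⊆ F) ⊎ (H ⊆ complement F)

IsRamseyNumber : ∀ {V W : Set} → SimpleGraph V → SimpleGraph W → ℕ → Set
IsRamseyNumber G H N = Arrows N G H × (∀ M → M < N → ¬ Arrows M G H)

-- k P_n : vertices (a , i) with a : Fin k the copy, i : Fin n position on
-- the path; (a,i) ~ (b,j) iff a = b and |i - j| = 1.
private
  consec : ℕ → ℕ → Bool
  consec i j = (j ≡ᵇ suc i) ∨ (i ≡ᵇ suc j)

  consec-irr : ∀ i → consec i i ≡ false
  consec-irr zero = refl
  consec-irr (suc i) = consec-irr i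

kP : (k n : ℕ) → SimpleGraph (Fin k × Fin n)
kP k n = record { adj = a ; adj-sym = s ; irrefl = ir }
  where
  a : Fin k × Fin n → Fin k × Fin n → Bool
  a (x , i) (y , j) = ⌊ x ≟ y ⌋ ∧ consec (toℕ i) (toℕ j)
  s : ∀ u v → a u v ≡ a v u
  s (x , i) (y , j) with x ≟ y | y ≟ x
  ... | yes _ | yes _ = ∨-comm (toℕ j ≡ᵇ suc (toℕ i)) (toℕ i ≡ᵇ suc (toℕ j))
  ... | yes p | no ¬q = ⊥-elim (¬q (sym p))
  ... | no ¬p | yes q = ⊥-elim (¬p (sym q))
  ... | no _  | no _  = refl
  ir : ∀ v → a v v ≡ false
  ir (x , i) with x ≟ x
  ... | yes _ = consec-irr (toℕ i)
  ... | no ¬p = ⊥-elim (¬p refl)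

-- Jahangir graph J_4: cycle 0-1-2-3-0 plus vertex 4 adjacent to the
-- alternate (opposite) cycle vertices 0 and 2.
private
  j4e : Fin 5 → Fin 5 → Bool
  j4e zero (suc zero) = true
  j4e (suc zero) (suc (suc zero)) = true
  j4e (suc (suc zero)) (suc (suc (suc zero))) = true
  j4e (suc (suc (suc zero))) zero = true
  j4e (suc (suc (suc (suc zero)))) zero = true
  j4e (suc (suc (suc (suc zero)))) (suc (suc zero)) = true
  j4e _ _ = false

  j4a : Fin 5 → Fin 5 → Bool
  j4a u v = j4e u v ∨ j4e v u

J4 : SimpleGraph (Fin 5)
J4 = record { adj = j4a ; adj-sym = λ u v → ∨-comm (j4e u v) (j4e v u) ; irrefl = ir }
  where
  ir : ∀ v → j4a v v ≡ false
  ir zero = refl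
  ir (suc zero) = refl
  ir (suc (suc zero)) = refl
  ir (suc (suc (suc zero))) = refl
  ir (suc (suc (suc (suc zero)))) = refl

module Submission where

-- J4 is K_{2,3}: two vertices each non-adjacent in F to three others (five distinct
-- vertices) give J4 ⊆ F̄ (`K₂,₃⇒J4`).  Paths are walks through duplicate-free vertex
-- lists; new paths are walks through a reordering of a longer such list (`longer`).
--
-- In F on N ≥ 6 vertices, a path leaving at least two vertices outside
-- can be lengthened unless F̄ ⊇ K_{2,3} (`grow`): an outside vertex adjacent to an end
-- extends it; otherwise a third outside vertex, or, if none is left, the second and
-- third vertices of the path force a longer path or a K_{2,3}.  Iterating yields a
-- path on N - 1 = kn vertices (`long-path`), which contains kPₙ (`path⇒kP`).
--
-- K_{M-1} plus an isolated vertex, with M ≤ kn, contains no kPₙ, which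
-- has kn vertices and none isolated (`no-spanning`), and its complement is a star,
-- which has no two disjoint edges and hence no J4 (`no-J4`).

open import Defs
open import Data.Nat as ℕ using (ℕ; zero; suc; _≤_; _<_; _+_; _*_; z≤n; s≤s)
import Data.Nat.Properties as ℕ
open import Data.Bool using (Bool; true; false; not)
open import Data.Bool.Properties using (T-∨; T-≡)
open import Data.Fin as Fin using (Fin; zero; suc; toℕ)
open import Data.Fin.Patterns using (0F; 1F; 2F; 3F; 4F)
import Data.Fin.Properties as Fin
open import Data.Product using (_×_; _,_; Σ; ∃)
open import Data.Sum as Sum using (_⊎_; inj₁; inj₂)
open import Data.Empty using (⊥-elim)
open import Data.List using (List; []; _∷_; _++_; [_]; length; lookup; reverse)
open import Data.List.Properties using (unfold-reverse)
open import Data.List.Membership.Propositional using (_∈_; _∉_)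
open import Data.List.Membership.Propositional.Properties using (∈-lookup)
open import Data.List.Membership.Setoid.Properties using (index-injective)
open import Data.List.Relation.Unary.Any using (any?; here; there)
open import Data.List.Relation.Unary.All as All using (All; []; _∷_)
open import Data.List.Relation.Unary.All.Properties using (¬Any⇒All¬; ++⁺; ++⁻ˡ; ++⁻ʳ)
open import Data.List.Relation.Unary.AllPairs using ([]; _∷_)
open import Data.List.Relation.Unary.Unique.Propositional using (Unique)
open import Data.List.Relation.Unary.Unique.Propositional.Properties using (drop⁺)
open import Data.List.Relation.Binary.Permutation.Propositional
  using (_↭_; ↭⇒↭ₛ; ↭-refl; ↭-prep; ↭-swap; ↭-trans; ↭-sym)
open import Data.List.Relation.Binary.Permutation.Propositional.Properties
  using (↭-length; shift; shifts; ++-comm; ↭-reverse)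
import Data.List.Relation.Binary.Permutation.Setoid.Properties as Perm
open import Function using (_∘_)
open import Function.Bundles using (Equivalence; Injection; _↣_)
open import Function.Definitions using (Injective)
open import Function.Properties.Inverse using (↔⇒↣)
open import Relation.Nullary using (¬_; yes; no; contradiction)
open import Relation.Nullary.Decidable using (⌊_⌋)
open import Relation.Binary.PropositionalEquality
  using (_≡_; _≢_; refl; sym; trans; cong; subst; setoid; module ≡-Reasoning)
open ≡-Reasoning

module _ {A : Set} where

  unique-resp-↭ : ∀ {xs ys : List A} → xs ↭ ys → Unique xs → Unique ys
  unique-resp-↭ xs↭ys = Perm.Unique-resp-↭ (setoid A) (↭⇒↭ₛ xs↭ys)

  head≢ : ∀ {x y : A} {xs} → Unique (x ∷ xs) → y ∈ xs → x ≢ y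
  head≢ (x≢xs ∷ _) = All.lookup x≢xs

  fresh-∷ : ∀ {x : A} {xs} → x ∉ xs → Unique xs → Unique (x ∷ xs)
  fresh-∷ x∉xs u = ¬Any⇒All¬ _ x∉xs ∷ u

  unique-swap : ∀ {x y : A} {xs} → Unique (x ∷ y ∷ xs) → Unique (y ∷ x ∷ xs)
  unique-swap {x} {y} = unique-resp-↭ (↭-swap x y ↭-refl)

  unique₃ : ∀ {x y z : A} → x ≢ y → x ≢ z → y ≢ z → Unique (x ∷ y ∷ z ∷ [])
  unique₃ x≢y x≢z y≢z = (x≢y ∷ x≢z ∷ []) ∷ (y≢z ∷ []) ∷ [] ∷ []

  lookup-injective : ∀ {xs : List A} → Unique xs → Injective _≡_ _≡_ (lookup xs)
  lookup-injective (_ ∷ _)     {zero}  {zero}  _ = refl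
  lookup-injective (x≢xs ∷ _)  {zero}  {suc j} e = ⊥-elim (All.lookup x≢xs (∈-lookup j) e)
  lookup-injective (x≢xs ∷ _)  {suc i} {zero}  e = ⊥-elim (All.lookup x≢xs (∈-lookup i) (sym e))
  lookup-injective (_ ∷ u)     {suc i} {suc j} e = cong suc (lookup-injective u e)

  restrict-tail : ∀ os {vs ws : List A} → Unique (os ++ vs) → Unique ws → All (_∈ vs) ws →
                  Unique (os ++ ws)
  restrict-tail []       _            uws _      = uws
  restrict-tail (o ∷ os) (o≢rest ∷ u) uws ws⊆vs =
    ++⁺ (++⁻ˡ os o≢rest) (All.map (All.lookup (++⁻ʳ os o≢rest)) ws⊆vs)
      ∷ restrict-tail os u uws ws⊆vs

-- A list with fewer than N entries misses some element of Fin N: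
-- otherwise the position of each element would inject Fin N into a smaller Fin.
fresh : ∀ {N} (vs : List (Fin N)) → length vs < N → ∃ λ x → x ∉ vs
fresh {N} vs short = Fin.¬∀⟶∃¬ N (_∈ vs) (λ x → any? (x Fin.≟_) vs) λ all∈ →
  Fin.<⇒notInjective short (λ {x} {y} → index-injective (setoid (Fin N)) (all∈ x) (all∈ y))

kP-edge : ∀ {k n} {c c′ : Fin k} {i j : Fin n} → adj (kP k n) (c , i) (c′ , j) ≡ true →
          c ≡ c′ × (toℕ j ≡ suc (toℕ i) ⊎ toℕ i ≡ suc (toℕ j))
kP-edge {c = c} {c′} {i} {j} e with c Fin.≟ c′
... | yes refl =
  refl , Sum.map (ℕ.≡ᵇ⇒≡ _ _) (ℕ.≡ᵇ⇒≡ _ _) (Equivalence.to T-∨ (Equivalence.from T-≡ e))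
... | no _ = contradiction e λ ()

kP-adjacent : ∀ {k n} (c : Fin k) {i j : Fin n} → toℕ j ≡ suc (toℕ i) →
              adj (kP k n) (c , i) (c , j) ≡ true
kP-adjacent c {i} {j} j≡i+1 with c Fin.≟ c
... | yes _   = Equivalence.to T-≡ (Equivalence.from T-∨ (inj₁ (ℕ.≡⇒≡ᵇ _ _ j≡i+1)))
... | no c≢c = contradiction refl c≢c

kP-no-isolated : ∀ {k n} → 2 ≤ n → (v : Fin k × Fin n) → ∃ λ w → adj (kP k n) v w ≡ true
kP-no-isolated {k} {n} (s≤s (s≤s _)) (c , zero) = (c , 1F) , kP-adjacent {k} {n} c {zero} {1F} refl
kP-no-isolated {k} {n} (s≤s (s≤s _)) (c , suc i) =
  (c , Fin.inject₁ i) ,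
  trans (adj-sym (kP k n) (c , suc i) (c , Fin.inject₁ i))
        (kP-adjacent c {Fin.inject₁ i} {suc i} (cong suc (sym (Fin.toℕ-inject₁ i))))

module InGraph {N : ℕ} (F : SimpleGraph (Fin N)) where

  Edge NonEdge : Fin N → Fin N → Set
  Edge    u v = adj F u v ≡ true
  NonEdge u v = adj F u v ≡ false

  edge-sym : ∀ {u v} → Edge u v → Edge v u
  edge-sym {u} {v} e = trans (adj-sym F v u) e

  nonEdge-sym : ∀ {u v} → NonEdge u v → NonEdge v u
  nonEdge-sym {u} {v} e = trans (adj-sym F v u) e

  edge⇒≢ : ∀ {u v} → Edge u v → u ≢ v
  edge⇒≢ {u} e refl with trans (sym e) (irrefl F u)
  ... | ()

  edge? : ∀ u v → Edge u v ⊎ NonEdge u v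
  edge? u v with adj F u v
  ... | true  = inj₁ refl
  ... | false = inj₂ refl

  nonEdge⇒coEdge : ∀ {u v} → u ≢ v → NonEdge u v → adj (complement F) u v ≡ true
  nonEdge⇒coEdge {u} {v} u≢v uv with u Fin.≟ v
  ... | yes u≡v = ⊥-elim (u≢v u≡v)
  ... | no _ rewrite uv = refl

  -- J4 is the complete bipartite graph K_{2,3} with parts {0,2} and {1,3,4}.
  K₂,₃⇒J4 : (p q r s t : Fin N) → Unique (p ∷ q ∷ r ∷ s ∷ t ∷ []) →
    NonEdge p r → NonEdge p s → NonEdge p t → NonEdge q r → NonEdge q s → NonEdge q t →
    J4 ⊆ complement F
  K₂,₃⇒J4 p q r s t distinct pr ps pt qr qs qt = f , f-injective , f-edge
    where
    -- the position in p, q, r, s, t of the image of each vertex of J4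
    σ : Fin 5 → Fin 5
    σ 0F = 0F
    σ 1F = 2F
    σ 2F = 1F
    σ 3F = 3F
    σ 4F = 4F

    σ-involutive : ∀ i → σ (σ i) ≡ i
    σ-involutive 0F = refl
    σ-involutive 1F = refl
    σ-involutive 2F = refl
    σ-involutive 3F = refl
    σ-involutive 4F = refl

    f : Fin 5 → Fin N
    f = lookup (p ∷ q ∷ r ∷ s ∷ t ∷ []) ∘ σ

    f-injective : ∀ {i j} → f i ≡ f j → i ≡ j
    f-injective {i} {j} e = trans (sym (σ-involutive i))
      (trans (cong σ (lookup-injective distinct e)) (σ-involutive j))

    co : ∀ i j → i ≢ j → NonEdge (f i) (f j) → adj (complement F) (f i) (f j) ≡ true
    co i j i≢j = nonEdge⇒coEdge (i≢j ∘ f-injective)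

    f-edge : ∀ i j → adj J4 i j ≡ true → adj (complement F) (f i) (f j) ≡ true
    f-edge 0F 0F ()
    f-edge 0F 1F _ = co 0F 1F (λ ()) pr
    f-edge 0F 2F ()
    f-edge 0F 3F _ = co 0F 3F (λ ()) ps
    f-edge 0F 4F _ = co 0F 4F (λ ()) pt
    f-edge 1F 0F _ = co 1F 0F (λ ()) (nonEdge-sym pr)
    f-edge 1F 1F ()
    f-edge 1F 2F _ = co 1F 2F (λ ()) (nonEdge-sym qr)
    f-edge 1F 3F ()
    f-edge 1F 4F ()
    f-edge 2F 0F ()
    f-edge 2F 1F _ = co 2F 1F (λ ()) qr
    f-edge 2F 2F ()
    f-edge 2F 3F _ = co 2F 3F (λ ()) qs
    f-edge 2F 4F _ = co 2F 4F (λ ()) qt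
    f-edge 3F 0F _ = co 3F 0F (λ ()) (nonEdge-sym ps)
    f-edge 3F 1F ()
    f-edge 3F 2F _ = co 3F 2F (λ ()) (nonEdge-sym qs)
    f-edge 3F 3F ()
    f-edge 3F 4F ()
    f-edge 4F 0F _ = co 4F 0F (λ ()) (nonEdge-sym pt)
    f-edge 4F 1F ()
    f-edge 4F 2F _ = co 4F 2F (λ ()) (nonEdge-sym qt)
    f-edge 4F 3F ()
    f-edge 4F 4F ()

  data Walk : Fin N → Fin N → List (Fin N) → Set where
    stop : ∀ {a} → Walk a a [ a ]
    step : ∀ {a b c vs} → Edge a b → Walk b c vs → Walk a c (a ∷ vs)

  append : ∀ {a b c d vs ws} → Walk a b vs → Edge b c → Walk c d ws → Walk a d (vs ++ ws)
  append stop        e W = step e W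
  append (step e′ V) e W = step e′ (append V e W)

  reverse-walk : ∀ {a b vs} → Walk a b vs → Walk b a (reverse vs)
  reverse-walk stop = stop
  reverse-walk {a} (step {vs = vs} e W) rewrite unfold-reverse a vs =
    append (reverse-walk W) (edge-sym e) stop

  start∈ : ∀ {a b vs} → Walk a b vs → a ∈ vs
  start∈ stop       = here refl
  start∈ (step _ _) = here refl

  end∈ : ∀ {a b vs} → Walk a b vs → b ∈ vs
  end∈ stop       = here refl
  end∈ (step _ W) = there (end∈ W)

  first-entry : ∀ {a b vs} → Walk a b vs → (j : Fin (length vs)) → toℕ j ≡ 0 → lookup vs j ≡ a
  first-entry stop       zero _ = refl
  first-entry (step _ _) zero _ = refl
  first-entry (step _ _) (suc _) ()

  walk-edge : ∀ {a b vs} → Walk a b vs → (i j : Fin (length vs)) → toℕ j ≡ suc (toℕ i) →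
              Edge (lookup vs i) (lookup vs j)
  walk-edge (step e W) zero    (suc j) j≡1 =
    subst (Edge _) (sym (first-entry W j (ℕ.suc-injective j≡1))) e
  walk-edge (step e W) (suc i) (suc j) j≡i+1 = walk-edge W i j (ℕ.suc-injective j≡i+1)
  walk-edge stop       zero    zero    ()
  walk-edge (step _ _) zero    zero    ()
  walk-edge (step _ _) (suc _) zero    ()

  record Path : Set where
    constructor path
    field
      {start finish} : Fin N
      vertices : List (Fin N)
      walk     : Walk start finish vertices
      distinct : Unique vertices

  Progress : List (Fin N) → Set
  Progress vs = (Σ Path λ Q → length vs < length (Path.vertices Q)) ⊎ J4 ⊆ complement F

  longer : ∀ {vs us c d ws} → Walk c d ws → ws ↭ us → Unique us → length vs < length us →
           Progress vs
  longer {ws = ws} W ws↭us us-distinct grows =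
    inj₁ (path ws W (unique-resp-↭ (↭-sym ws↭us) us-distinct) ,
          subst (_ <_) (sym (↭-length ws↭us)) grows)

  extend-start : ∀ {a b z vs} → Walk a b vs → Unique (z ∷ vs) → Edge z a → Progress vs
  extend-start {vs = vs} W u za = longer {vs} (step za W) ↭-refl u ℕ.≤-refl

  extend-end : ∀ {a b z vs} → Walk a b vs → Unique (z ∷ vs) → Edge b z → Progress vs
  extend-end {z = z} {vs} W u bz = longer {vs} (append W bz stop) (++-comm vs [ z ]) u ℕ.≤-refl

  edge-path : ∀ {a p q} → Edge p q → Progress (a ∷ [])
  edge-path {a} e = longer {a ∷ []} (step e stop) ↭-refl ((edge⇒≢ e ∷ []) ∷ [] ∷ []) ℕ.≤-refl

  -- Two further vertices z, w exist; any edge among the pairs az, aw, xy, xz, xw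
  -- is a path on two vertices, and otherwise {a, x} and {y, z, w} span K_{2,3} in F̄.
  grow-single : ∀ {a x y} → 5 ≤ N → Unique (y ∷ x ∷ a ∷ []) → NonEdge x a → NonEdge y a →
                Progress (a ∷ [])
  grow-single {a} {x} {y} five u xa ya
    with fresh (y ∷ x ∷ a ∷ []) (ℕ.<⇒≤ five)
  ... | z , z∉ with fresh (z ∷ y ∷ x ∷ a ∷ []) five
  ... | w , w∉ with edge? a z | edge? a w | edge? x y | edge? x z | edge? x w
  ... | inj₁ e | _      | _      | _      | _      = edge-path {a} e
  ... | _      | inj₁ e | _      | _      | _      = edge-path {a} e
  ... | _      | _      | inj₁ e | _      | _      = edge-path {a} e
  ... | _      | _      | _      | inj₁ e | _      = edge-path {a} e
  ... | _      | _      | _      | _      | inj₁ e = edge-path {a} e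
  ... | inj₂ az | inj₂ aw | inj₂ xy | inj₂ xz | inj₂ xw =
    inj₂ (K₂,₃⇒J4 a x y z w distinct (nonEdge-sym ya) az aw xy xz xw)
    where
    distinct : Unique (a ∷ x ∷ y ∷ z ∷ w ∷ [])
    distinct = unique-resp-↭ (↭-sym (↭-reverse (w ∷ z ∷ y ∷ x ∷ a ∷ [])))
                 (fresh-∷ w∉ (fresh-∷ z∉ u))

  -- A third outside vertex z either extends the path
  -- or {a, b} and {x, y, z} span K_{2,3} in F̄.
  grow-roomy : ∀ {a b vs x y} → Walk a b vs → a ≢ b → 3 + length vs ≤ N →
               Unique (y ∷ x ∷ vs) → NonEdge x a → NonEdge y a → NonEdge b x → NonEdge b y →
               Progress vs
  grow-roomy {a} {b} {vs} {x} {y} W a≢b room u xa ya bx by with fresh (y ∷ x ∷ vs) room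
  ... | z , z∉ with edge? z a | edge? b z
  ... | inj₁ za | _       = extend-start W (fresh-∷ (z∉ ∘ there ∘ there) (drop⁺ 2 u)) za
  ... | _       | inj₁ bz = extend-end W (fresh-∷ (z∉ ∘ there ∘ there) (drop⁺ 2 u)) bz
  ... | inj₂ za | inj₂ bz =
    inj₂ (K₂,₃⇒J4 a b x y z distinct (nonEdge-sym xa) (nonEdge-sym ya) (nonEdge-sym za) bx by bz)
    where
    distinct : Unique (a ∷ b ∷ x ∷ y ∷ z ∷ [])
    distinct = unique-resp-↭ (↭-sym (↭-reverse (z ∷ y ∷ x ∷ b ∷ a ∷ [])))
      (restrict-tail (z ∷ y ∷ x ∷ []) (fresh-∷ z∉ u) ((a≢b ∘ sym ∷ []) ∷ [] ∷ [])
        (end∈ W ∷ start∈ W ∷ []))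

  -- A path a, v₂, v₃, …, b on at least four vertices (b lies strictly after v₃), with
  -- vertices x, y outside it that are non-adjacent to both ends.  Here no vertex beyond
  -- x and y is available, and the inner vertices v₂, v₃ are used instead.
  module Tight {a v₂ v₃ b : Fin N} {rest : List (Fin N)}
    (av₂ : Edge a v₂) (v₂v₃ : Edge v₂ v₃) (W₃ : Walk v₃ b (v₃ ∷ rest)) (b∈rest : b ∈ rest)
    (u : Unique (a ∷ v₂ ∷ v₃ ∷ rest)) where

    vs : List (Fin N)
    vs = a ∷ v₂ ∷ v₃ ∷ rest

    a∈ : a ∈ vs
    a∈ = here refl
    v₂∈ : v₂ ∈ vs
    v₂∈ = there (here refl)
    v₃∈ : v₃ ∈ vs
    v₃∈ = there (there (here refl))
    b∈ : b ∈ vs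
    b∈ = there (there (there b∈rest))

    a≢b : a ≢ b
    a≢b = head≢ u (there (there b∈rest))
    a≢v₂ : a ≢ v₂
    a≢v₂ = head≢ u (here refl)
    a≢v₃ : a ≢ v₃
    a≢v₃ = head≢ u (there (here refl))
    v₂≢b : v₂ ≢ b
    v₂≢b = head≢ (drop⁺ 1 u) (there b∈rest)
    v₃≢b : v₃ ≢ b
    v₃≢b = head≢ (drop⁺ 2 u) b∈rest

    insert : ∀ {x} → Unique (x ∷ vs) → Edge v₂ x → Edge x v₃ → Progress vs
    insert {x} ux v₂x xv₃ =
      longer {vs} (step av₂ (step v₂x (step xv₃ W₃))) (shift x (a ∷ v₂ ∷ []) (v₃ ∷ rest)) ux ℕ.≤-refl

    around : ∀ {x y w} → Unique (y ∷ x ∷ vs) → w ∈ vs → a ≢ w → b ≢ w →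
             NonEdge x a → NonEdge y a → NonEdge b x → NonEdge b y →
             NonEdge x w → NonEdge y w → Progress vs
    around {x} {y} {w} u′ w∈ a≢w b≢w xa ya bx by xw yw =
      inj₂ (K₂,₃⇒J4 y x a b w
        (restrict-tail (y ∷ x ∷ []) u′ (unique₃ a≢b a≢w b≢w) (a∈ ∷ b∈ ∷ w∈ ∷ []))
        ya (nonEdge-sym by) yw xa (nonEdge-sym bx) xw)

    -- With x ~ v₂ and an edge ba, the cycle a v₂ … b a is entered at v₂: x v₂ … b a.
    through-cycle : ∀ {x} → Unique (x ∷ vs) → Edge x v₂ → Edge b a → Progress vs
    through-cycle {x} ux xv₂ ba =
      longer {vs} (step xv₂ (append (step v₂v₃ W₃) ba stop))
        (↭-prep x (++-comm (v₂ ∷ v₃ ∷ rest) [ a ])) ux ℕ.≤-refl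

    detour : ∀ {x y} → Unique (x ∷ y ∷ vs) → Edge v₂ x → Edge x y → Edge y v₃ → Progress vs
    detour {x} {y} uxy v₂x xy yv₃ =
      longer {vs} (step av₂ (step v₂x (step xy (step yv₃ W₃))))
        (shifts (a ∷ v₂ ∷ []) (x ∷ y ∷ [])) uxy (ℕ.n≤1+n _)

    -- With x ~ v₂, v₂ ~ b and v₃ ~ a, the path x v₂ b … v₃ a (the tail reversed).
    reroute : ∀ {x} → Unique (x ∷ vs) → Edge x v₂ → Edge v₂ b → Edge v₃ a → Progress vs
    reroute {x} ux xv₂ v₂b v₃a =
      longer {vs} (step xv₂ (step v₂b (append (reverse-walk W₃) v₃a stop)))
        (↭-prep x (↭-trans (↭-prep v₂ (↭-trans (++-comm (reverse (v₃ ∷ rest)) [ a ])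
                                                  (↭-prep a (↭-reverse (v₃ ∷ rest)))))
                           (↭-swap v₂ a ↭-refl)))
        ux ℕ.≤-refl

    -- The edges
    -- ba, xy, v₂b and v₃a lead to `through-cycle`, `detour` and `reroute`; if they are
    -- all missing, {y, b} and {x, a, v₂}, or {x, a} and {y, b, v₃}, span K_{2,3} in F̄.
    crossed : ∀ {x y} → Unique (y ∷ x ∷ vs) →
              NonEdge x a → NonEdge y a → NonEdge b x → NonEdge b y →
              Edge v₂ x → Edge y v₃ → NonEdge v₂ y → NonEdge x v₃ → Progress vs
    crossed {x} {y} u′ xa ya bx by v₂x yv₃ v₂y xv₃ with edge? b a | edge? x y
    ... | inj₁ ba | _       = through-cycle (drop⁺ 1 u′) (edge-sym v₂x) ba
    ... | _       | inj₁ xy = detour (unique-swap u′) v₂x xy yv₃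
    ... | inj₂ ba | inj₂ xy with edge? v₂ b | edge? v₃ a
    ...   | inj₁ v₂b | inj₁ v₃a = reroute (drop⁺ 1 u′) (edge-sym v₂x) v₂b v₃a
    ...   | inj₂ v₂b | _ =
      inj₂ (K₂,₃⇒J4 y b x a v₂
        (unique-resp-↭ (↭-prep y (↭-swap x b ↭-refl))
          (restrict-tail (y ∷ x ∷ []) u′ (unique₃ (a≢b ∘ sym) (v₂≢b ∘ sym) a≢v₂)
            (b∈ ∷ a∈ ∷ v₂∈ ∷ [])))
        (nonEdge-sym xy) ya (nonEdge-sym v₂y) bx ba (nonEdge-sym v₂b))
    ...   | _ | inj₂ v₃a =
      inj₂ (K₂,₃⇒J4 x a y b v₃
        (unique-resp-↭ (↭-prep x (↭-swap y a ↭-refl))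
          (restrict-tail (x ∷ y ∷ []) (unique-swap u′) (unique₃ a≢b a≢v₃ (v₃≢b ∘ sym))
            (a∈ ∷ b∈ ∷ v₃∈ ∷ [])))
        xy (nonEdge-sym bx) xv₃ (nonEdge-sym ya) (nonEdge-sym ba) (nonEdge-sym v₃a))

    grow-tight : ∀ {x y} → Unique (y ∷ x ∷ vs) →
                 NonEdge x a → NonEdge y a → NonEdge b x → NonEdge b y → Progress vs
    grow-tight {x} {y} u′ xa ya bx by with edge? v₂ x | edge? v₂ y | edge? x v₃ | edge? y v₃
    ... | inj₂ v₂x | inj₂ v₂y | _ | _ =
      around u′ v₂∈ a≢v₂ (v₂≢b ∘ sym) xa ya bx by (nonEdge-sym v₂x) (nonEdge-sym v₂y)
    ... | _ | _ | inj₂ xv₃ | inj₂ yv₃ =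
      around u′ v₃∈ a≢v₃ (v₃≢b ∘ sym) xa ya bx by xv₃ yv₃
    ... | inj₁ v₂x | _ | inj₁ xv₃ | _ = insert (drop⁺ 1 u′) v₂x xv₃
    ... | _ | inj₁ v₂y | _ | inj₁ yv₃ = insert (drop⁺ 1 (unique-swap u′)) v₂y yv₃
    ... | inj₁ v₂x | inj₂ v₂y | inj₂ xv₃ | inj₁ yv₃ = crossed u′ xa ya bx by v₂x yv₃ v₂y xv₃
    ... | inj₂ v₂x | inj₁ v₂y | inj₁ xv₃ | inj₂ yv₃ =
      crossed (unique-swap u′) ya xa by bx v₂y xv₃ v₂x yv₃

  -- A path leaving exactly two vertices outside has N - 2 ≥ 4 vertices.
  grow-stuck : ∀ {a b vs x y} → 6 ≤ N → Walk a b vs → Unique (y ∷ x ∷ vs) →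
               NonEdge x a → NonEdge y a → NonEdge b x → NonEdge b y → Progress vs
  grow-stuck six stop u xa ya _ _ = grow-single (ℕ.<⇒≤ six) u xa ya
  grow-stuck {vs = vs} six (step e W) u xa ya bx by with 3 + length vs ℕ.≤? N
  ... | yes room = grow-roomy (step e W) (head≢ (drop⁺ 2 u) (end∈ W)) room u xa ya bx by
  grow-stuck six (step _ stop) _ _ _ _ _ | no full = ⊥-elim (full (ℕ.<⇒≤ six))
  grow-stuck six (step _ (step _ stop)) _ _ _ _ _ | no full = ⊥-elim (full six)
  grow-stuck six (step av₂ (step v₂v₃ W₃@(step _ W₄))) u xa ya bx by | no _ =
    Tight.grow-tight av₂ v₂v₃ W₃ (end∈ W₄) (drop⁺ 2 u) u xa ya bx by

  grow : ∀ {a b vs} → 6 ≤ N → Walk a b vs → Unique vs → 2 + length vs ≤ N → Progress vs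
  grow {a} {b} {vs} six W u room with fresh vs (ℕ.<⇒≤ room)
  ... | x , x∉ with fresh (x ∷ vs) room
  ... | y , y∉ with edge? x a | edge? y a | edge? b x | edge? b y
  ... | inj₁ xa | _       | _       | _       = extend-start W (fresh-∷ x∉ u) xa
  ... | _       | inj₁ ya | _       | _       = extend-start W (fresh-∷ (y∉ ∘ there) u) ya
  ... | _       | _       | inj₁ bx | _       = extend-end W (fresh-∷ x∉ u) bx
  ... | _       | _       | _       | inj₁ by = extend-end W (fresh-∷ (y∉ ∘ there) u) by
  ... | inj₂ xa | inj₂ ya | inj₂ bx | inj₂ by =
    grow-stuck six W (fresh-∷ y∉ (fresh-∷ x∉ u)) xa ya bx by

  long-path : 6 ≤ N → ∀ m → m < N →
              (Σ Path λ P → m ≤ length (Path.vertices P)) ⊎ J4 ⊆ complement F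
  long-path six zero 0<N = inj₁ (path [ Fin.fromℕ< 0<N ] stop ([] ∷ []) , z≤n)
  long-path six (suc m) m+1<N with long-path six m (ℕ.<⇒≤ m+1<N)
  ... | inj₂ j4 = inj₂ j4
  ... | inj₁ (P , m≤|P|) with suc m ℕ.≤? length (Path.vertices P)
  ...   | yes enough = inj₁ (P , enough)
  ...   | no short with grow six (Path.walk P) (Path.distinct P)
                          (ℕ.≤-trans (s≤s (s≤s (ℕ.≤-pred (ℕ.≰⇒> short)))) m+1<N)
  ...     | inj₁ (Q , |P|<|Q|) = inj₁ (Q , ℕ.≤-trans (s≤s m≤|P|) |P|<|Q|)
  ...     | inj₂ j4 = inj₂ j4

  -- A path on at least k·n vertices contains kPₙ: copy c of Pₙ runs along the
  -- consecutive positions n·c, …, n·c + n - 1 of the path.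
  path⇒kP : ∀ {a b vs} k n → Walk a b vs → Unique vs → k * n ≤ length vs → kP k n ⊆ F
  path⇒kP {vs = vs} k n W u kn≤ = f , f-injective , f-edge
    where
    pos : Fin k × Fin n → Fin (length vs)
    pos (c , i) = Fin.inject≤ (Fin.combine c i) kn≤

    toℕ-pos : ∀ c i → toℕ (pos (c , i)) ≡ n * toℕ c + toℕ i
    toℕ-pos c i = trans (Fin.toℕ-inject≤ (Fin.combine c i) kn≤) (Fin.toℕ-combine c i)

    f : Fin k × Fin n → Fin N
    f = lookup vs ∘ pos

    f-injective : Injective _≡_ _≡_ f
    f-injective {c , i} {c′ , i′} e
      with Fin.combine-injective c i c′ i′ (Fin.inject≤-injective kn≤ kn≤ _ _ (lookup-injective u e))
    ... | refl , refl = refl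

    next : ∀ c i j → toℕ j ≡ suc (toℕ i) → Edge (f (c , i)) (f (c , j))
    next c i j j≡i+1 = walk-edge W (pos (c , i)) (pos (c , j)) (begin
      toℕ (pos (c , j))        ≡⟨ toℕ-pos c j ⟩
      n * toℕ c + toℕ j        ≡⟨ cong (n * toℕ c +_) j≡i+1 ⟩
      n * toℕ c + suc (toℕ i)  ≡⟨ ℕ.+-suc (n * toℕ c) (toℕ i) ⟩
      suc (n * toℕ c + toℕ i)  ≡⟨ cong suc (toℕ-pos c i) ⟨
      suc (toℕ (pos (c , i)))  ∎)

    f-edge : ∀ v w → adj (kP k n) v w ≡ true → Edge (f v) (f w)
    f-edge (c , i) (c′ , j) e with kP-edge {c = c} {c′} {i} {j} e
    ... | refl , inj₁ j≡i+1 = next c i j j≡i+1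
    ... | refl , inj₂ i≡j+1 = edge-sym (next c j i i≡j+1)

clique-adj : ∀ {M} → Fin M → Fin M → Bool
clique-adj zero    _       = false
clique-adj (suc _) zero    = false
clique-adj (suc u) (suc v) = not ⌊ u Fin.≟ v ⌋

clique-adj-sym : ∀ {M} (u v : Fin M) → clique-adj u v ≡ clique-adj v u
clique-adj-sym zero    zero    = refl
clique-adj-sym zero    (suc _) = refl
clique-adj-sym (suc _) zero    = refl
clique-adj-sym (suc u) (suc v) = cong not (⌊≟⌋-sym u v)
  where
  ⌊≟⌋-sym : ∀ {M} (u v : Fin M) → ⌊ u Fin.≟ v ⌋ ≡ ⌊ v Fin.≟ u ⌋
  ⌊≟⌋-sym u v with u Fin.≟ v | v Fin.≟ u
  ... | yes _   | yes _   = refl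
  ... | no _    | no _    = refl
  ... | yes u≡v | no v≢u = contradiction (sym u≡v) v≢u
  ... | no u≢v  | yes v≡u = contradiction (sym v≡u) u≢v

clique-adj-irrefl : ∀ {M} (u : Fin M) → clique-adj u u ≡ false
clique-adj-irrefl zero = refl
clique-adj-irrefl (suc u) with u Fin.≟ u
... | yes _   = refl
... | no u≢u = contradiction refl u≢u

cliqueAndIsolated : (M : ℕ) → SimpleGraph (Fin M)
cliqueAndIsolated M = record
  { adj = clique-adj ; adj-sym = clique-adj-sym ; irrefl = clique-adj-irrefl }

star : ∀ {M} (u v : Fin (suc M)) → adj (complement (cliqueAndIsolated (suc M))) u v ≡ true →
       u ≡ zero ⊎ v ≡ zero
star zero    _       _ = inj₁ refl
star (suc _) zero    _ = inj₂ refl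
star (suc u) (suc v) e with u Fin.≟ v
star (suc u) (suc v) () | yes _
star (suc u) (suc v) () | no _

-- A star has no two disjoint edges, but J4 has the disjoint edges 01 and 23.
no-J4 : ∀ M → ¬ (J4 ⊆ complement (cliqueAndIsolated M))
no-J4 zero    (f , _) with f 0F
... | ()
no-J4 (suc M) (f , f-inj , f-edge) with star _ _ (f-edge 0F 1F refl) | star _ _ (f-edge 2F 3F refl)
... | inj₁ f0≡0 | inj₁ f2≡0 = contradiction (f-inj (trans f0≡0 (sym f2≡0))) λ ()
... | inj₁ f0≡0 | inj₂ f3≡0 = contradiction (f-inj (trans f0≡0 (sym f3≡0))) λ ()
... | inj₂ f1≡0 | inj₁ f2≡0 = contradiction (f-inj (trans f1≡0 (sym f2≡0))) λ ()
... | inj₂ f1≡0 | inj₂ f3≡0 = contradiction (f-inj (trans f1≡0 (sym f3≡0))) λ ()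

-- A graph without isolated vertices avoids the isolated vertex 0 under any embedding
-- into cliqueAndIsolated M, so it embeds only if it has at most M - 1 vertices.  Here
-- "at least M vertices" is witnessed by an injection from Fin m with M ≤ m and m > 0.
no-spanning : ∀ {V : Set} {m M} (H : SimpleGraph V) → Fin m ↣ V → 0 < m → M ≤ m →
              (∀ v → ∃ λ w → adj H v w ≡ true) → ¬ (H ⊆ cliqueAndIsolated M)
no-spanning {M = zero} H enum 0<m _ _ (f , _) with f (Injection.to enum (Fin.fromℕ< 0<m))
... | ()
no-spanning {m = m} {suc M} H enum _ M<m no-isolated (f , f-injective , f-edge) =
  Fin.<⇒notInjective M<m g-injective
  where
  avoids-0 : ∀ v → zero ≢ f v
  avoids-0 v 0≡fv with no-isolated v
  ... | w , vw =
    contradiction (subst (λ x → clique-adj x (f w) ≡ true) (sym 0≡fv) (f-edge v w vw)) λ ()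
  g : Fin m → Fin M
  g i = Fin.punchOut (avoids-0 (Injection.to enum i))
  g-injective : Injective _≡_ _≡_ g
  g-injective e = Injection.injective enum
    (f-injective (Fin.punchOut-injective (avoids-0 _) (avoids-0 _) e))

five≤kn : ∀ n k → 4 ≤ n → 1 ≤ k → ¬ ((n , k) ≡ (4 , 1)) → 5 ≤ k * n
five≤kn n 1 4≤n _ nk≢41 =
  ℕ.≤-trans (ℕ.≤∧≢⇒< 4≤n (λ 4≡n → nk≢41 (cong (_, 1) (sym 4≡n)))) (ℕ.m≤n*m n 1)
five≤kn n (suc (suc k)) 4≤n _ _ =
  ℕ.≤-trans (ℕ.m≤m+n 5 3) (ℕ.*-mono-≤ {2} {suc (suc k)} (s≤s (s≤s z≤n)) 4≤n)

upper-bound : ∀ k n N → 6 ≤ N → k * n < N → Arrows N (kP k n) J4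
upper-bound k n N six kn<N F with InGraph.long-path F six (k * n) kn<N
... | inj₁ (P , kn≤|P|) =
  inj₁ (InGraph.path⇒kP F k n (InGraph.Path.walk P) (InGraph.Path.distinct P) kn≤|P|)
... | inj₂ J4⊆F̄ = inj₂ J4⊆F̄

lower-bound : ∀ k n M → 1 ≤ k → 2 ≤ n → M ≤ k * n → ¬ Arrows M (kP k n) J4
lower-bound k n M 1≤k 2≤n M≤kn arrows with arrows (cliqueAndIsolated M)
... | inj₁ kP⊆G  = no-spanning (kP k n) (↔⇒↣ Fin.*↔×) (ℕ.*-mono-≤ 1≤k (ℕ.≤-trans (s≤s z≤n) 2≤n))
                     M≤kn (kP-no-isolated 2≤n) kP⊆G
... | inj₂ J4⊆Ḡ = no-J4 M J4⊆Ḡ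

-- Here N = kn + 1 ≥ 6 exactly because (n, k) ≠ (4, 1).
theorem2 : (n k : ℕ) → 4 ≤ n → 1 ≤ k → ¬ ((n , k) ≡ (4 , 1)) →
    IsRamseyNumber (kP k n) J4 (k * n + 1)
theorem2 n k 4≤n 1≤k nk≢41 rewrite ℕ.+-comm (k * n) 1 =
  upper-bound k n (suc (k * n)) (s≤s (five≤kn n k 4≤n 1≤k nk≢41)) (ℕ.n<1+n (k * n)) ,
  λ M M≤kn → lower-bound k n M 1≤k (ℕ.≤-trans (s≤s (s≤s z≤n)) 4≤n) (ℕ.≤-pred M≤kn)
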